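{- Let $\xi_1,\ldots,\xi_n$ and $\kappa_1,\ldots,\kappa_m$ ($n,m\ge 1$) be positions such that $\mathcal{M}_{\mathrm{cl}(\xi_i)} \cong \mathcal{M}_{\mathrm{cl}(\kappa_j)} \cong \mathcal{M}_{\mathrm{cl}(*)}$ for all $i\in\{1,\ldots,n\}$, $j\in\{1,\ldots,m\}$. Then: (1) If $o^-(\xi_i)=o^-(\kappa_j)$ for all $i,j$, then $\mathcal{M}_{\mathrm{cl}(\{\xi_1,\ldots,\xi_n \mid \kappa_1,\ldots,\kappa_m\})}\cong \mathcal{M}_{\mathrm{cl}(*)}$. (2) If $o^-(\xi_i)=\mathcal{P}$ for all $i$, then $\mathcal{M}_{\mathrm{cl}(\{\xi_1,\ldots,\xi_n \mid \cdot\})}\cong \mathcal{M}_{\mathrm{cl}(*)}$. (3) If $o^-(\xi_i)=o^-(\kappa_j)=\mathcal{N}$ for all $i,j$, then each of $\mathcal{M}_{\mathrm{cl}(\{\xi_1,\ldots,\xi_n\mid 0\})}$, $\mathcal{M}_{\mathrm{cl}(\{\xi_1,\ldots,\xi_n\mid \kappa_1,\ldots,\kappa_m,0\})}$ and $\mathcal{M}_{\mathrm{cl}(\{\xi_1,\ldots,\xi_n,0\mid \kappa_1,\ldots,\kappa_m,0\})}$ is isomorphic to $\mathcal{M}_{\mathrm{cl}(*)}$. (4) For each $i,j$, $\mathcal{M}_{\mathrm{cl}(\overline{\xi_i})}\cong\mathcal{M}_{\mathrm{cl}(\overline{\kappa_j})}\cong\mathcal{M}_{\mathrm{cl}(*)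}$.
   Context: A position $\xi=\{\xi^L \mid \xi^R\}$ is given recursively by finite sets of Left and Right options; $\cdot$ denotes an empty option set; $\{\alpha_1,\dots\mid\beta_1,\dots\}$ is the position with the listed Left and Right options. $0=\{\cdot\mid\cdot\}$, $*=\{0\mid 0\}$. The conjugate is $\overline{\xi}=\{\overline{\xi^R}\mid\overline{\xi^L}\}$. Disjunctive sum: $\alpha+\beta=\{\alpha^L+\beta,\alpha+\beta^L \mid \alpha^R+\beta,\alpha+\beta^R\}$. Under misère play a player unable to move on their turn wins; $o^-(\xi)\in\{\mathcal{L},\mathcal{R},\mathcal{N},\mathcal{P}\}$ is the misère outcome (Left wins always / Right wins always / next player wins / next player loses). $\mathrm{cl}(\Upsilon)$ is the smallest set containing $\Upsilon$ closed under disjunctive sum and taking options. For closed $\Gamma$, $\alpha\equiv\beta\pmod\Gamma$ iff $o^-(\alpha+\gamma)=o^-(\beta+\gamma)$ for all $\gamma\in\Gamma$; the misère monoid $\mathcal{M}_\Gamma$ is the quotient monoid (operation induced by $+$, identity the class of $0$) with each class labelled by its members' misère outcome. Isomorphism of misère monoids means a monoid isomorphism which with its inverse preserves outcomes. $\mathcal{M}_{\mathrm{cl}(*)}=\{1,a\}$, $a^2=1$, $1$ of outcome $\mathcal{N}$, $a$ of outcome $\mathcal{P}$. -}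

module Defs where

open import Data.Bool using (Bool; true; false; not; _∨_; _∧_)
open import Data.List using (List; []; _∷_; _++_)
open import Data.List.Membership.Propositional using (_∈_)
open import Data.Product using (Σ; _,_; proj₁; proj₂)
open import Relation.Binary.PropositionalEquality using (_≡_)

data Game : Set where
  ⟨_∣_⟩ : List Game → List Game → Game

leftOpts : Game → List Game
leftOpts ⟨ l ∣ r ⟩ = l

rightOpts : Game → List Game
rightOpts ⟨ l ∣ r ⟩ = r

zeroG : Game
zeroG = ⟨ [] ∣ [] ⟩

star : Game
star = ⟨ zeroG ∷ [] ∣ zeroG ∷ [] ⟩

mutual
  conj : Game → Game
  conj ⟨ l ∣ r ⟩ = ⟨ conjList r ∣ conjList l ⟩

  conjList : List Game → List Game
  conjList [] = []
  conjList (g ∷ gs) = conj g ∷ conjList gs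

mutual
  _⊕_ : Game → Game → Game
  g@(⟨ gl ∣ gr ⟩) ⊕ h@(⟨ hl ∣ hr ⟩) =
    ⟨ addL gl h ++ addR g hl ∣ addL gr h ++ addR g hr ⟩

  addL : List Game → Game → List Game
  addL [] h = []
  addL (x ∷ xs) h = (x ⊕ h) ∷ addL xs h

  addR : Game → List Game → List Game
  addR g [] = []
  addR g (y ∷ ys) = (g ⊕ y) ∷ addR g ys

infixl 6 _⊕_

-- Misère play: a player unable to move on their turn wins.
-- leftFirst g  : Left, moving first in g, has a winning strategy.
-- rightFirst g : Right, moving first in g, has a winning strategy.
mutual
  leftFirst : Game → Bool
  leftFirst ⟨ [] ∣ r ⟩ = true
  leftFirst ⟨ x ∷ xs ∣ r ⟩ = someRightLoses (x ∷ xs)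

  rightFirst : Game → Bool
  rightFirst ⟨ l ∣ [] ⟩ = true
  rightFirst ⟨ l ∣ y ∷ ys ⟩ = someLeftLoses (y ∷ ys)

  someRightLoses : List Game → Bool
  someRightLoses [] = false
  someRightLoses (g ∷ gs) = not (rightFirst g) ∨ someRightLoses gs

  someLeftLoses : List Game → Bool
  someLeftLoses [] = false
  someLeftLoses (g ∷ gs) = not (leftFirst g) ∨ someLeftLoses gs

data Outcome : Set where
  𝓛 𝓡 𝓝 𝓟 : Outcome

outcomeOf : Bool → Bool → Outcome
outcomeOf true  true  = 𝓝
outcomeOf true  false = 𝓛
outcomeOf false true  = 𝓡
outcomeOf false false = 𝓟

o⁻ : Game → Outcome
o⁻ g = outcomeOf (leftFirst g) (rightFirst g)

data Cl (Υ : Game → Set) : Game → Set where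
  base : ∀ {g} → Υ g → Cl Υ g
  sum  : ∀ {g h} → Cl Υ g → Cl Υ h → Cl Υ (g ⊕ h)
  optL : ∀ {g x} → Cl Υ g → x ∈ leftOpts g → Cl Υ x
  optR : ∀ {g x} → Cl Υ g → x ∈ rightOpts g → Cl Υ x

cl : Game → Game → Set
cl ξ = Cl (λ g → g ≡ ξ)

_≡[_]_ : Game → (Game → Set) → Game → Set
α ≡[ Γ ] β = ∀ γ → Γ γ → o⁻ (α ⊕ γ) ≡ o⁻ (β ⊕ γ)

-- Elements of Γ (representatives of classes of the misère monoid M_Γ)
Elt : (Game → Set) → Set
Elt Γ = Σ Game Γ

-- Isomorphism of misère monoids M_Γ ≅ M_Δ, for closed Γ, Δ,
-- presented on representatives: maps f, g respecting the congruences,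
-- mutually inverse on classes, multiplicative, sending identity to identity,
-- and (together with the inverse) preserving the outcome labels.
record MisereIso (Γ Δ : Game → Set) : Set where
  field
    to       : Elt Γ → Elt Δ
    from     : Elt Δ → Elt Γ
    to-cong  : ∀ x y → proj₁ x ≡[ Γ ] proj₁ y → proj₁ (to x) ≡[ Δ ] proj₁ (to y)
    from-cong : ∀ x y → proj₁ x ≡[ Δ ] proj₁ y → proj₁ (from x) ≡[ Γ ] proj₁ (from y)
    from-to  : ∀ x → proj₁ (from (to x)) ≡[ Γ ] proj₁ x
    to-from  : ∀ y → proj₁ (to (from y)) ≡[ Δ ] proj₁ y
    to-hom   : ∀ x y (p : Γ (proj₁ x ⊕ proj₁ y)) →
               proj₁ (to (proj₁ x ⊕ proj₁ y , p)) ≡[ Δ ] (proj₁ (to x) ⊕ proj₁ (to y))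
    to-unit  : (p : Γ zeroG) → proj₁ (to (zeroG , p)) ≡[ Δ ] zeroG
    to-out   : ∀ x → o⁻ (proj₁ (to x)) ≡ o⁻ (proj₁ x)
    from-out : ∀ y → o⁻ (proj₁ (from y)) ≡ o⁻ (proj₁ y)

_≅ₘ_ : Game → Game → Set
ξ ≅ₘ ζ = MisereIso (cl ξ) (cl ζ)

module Submission where

-- Call a position *-like of parity c (`Parity c g`) if, hereditarily, an even
-- position has only odd options and an odd one has Left and Right options,
-- all even.  The misère outcome of a *-like position is fixed by its parity
-- (even ↦ 𝓝, odd ↦ 𝓟); parities add (xor) under sums, flip under options and
-- survive conjugation, so modulo a set of *-like positions containing 0, two
-- *-like positions are equivalent iff their parities agree.  Hence any two
-- such sets that also contain an odd position have misère monoids ≅ ℤ/2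
-- (parityClosure-iso); in particular M_cl(ξ) ≅ M_cl(*) for nonzero *-like ξ.
-- Conversely (FromStarIso), M_cl(ξ) ≅ M_cl(*) makes ξ nonzero and *-like of
-- parity "o⁻ is 𝓟": parity is additive on cl(ξ), being transported from
-- cl(*), and the odd y = from(*) detects the parity of options of g via the
-- outcome of g + y.  The theorem then reduces to checking that the new
-- positions are nonzero and *-like.

open import Defs
open import Data.List using (List; []; _∷_; _++_)
open import Data.List.Membership.Propositional using (_∈_)
open import Data.Product using (_×_)
open import Relation.Binary.PropositionalEquality using (_≡_; _≢_)

open import Data.Bool using (Bool; true; false; not; _xor_)
open import Data.Bool.Properties
  using (not-injective; ∨-conicalˡ; ∨-conicalʳ; xor-comm; true-xor; xor-identityʳ)
open import Data.Empty using (⊥-elim)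
open import Data.List.Properties using (++-conicalʳ)
open import Data.List.Membership.Propositional.Properties using (∈-++⁺ˡ)
open import Data.List.Relation.Unary.All using (All; []; _∷_; lookup; tabulate)
open import Data.List.Relation.Unary.All.Properties using (++⁺)
open import Data.List.Relation.Unary.Any using (here; there)
open import Data.Product using (Σ; _,_; proj₁; proj₂)
open import Function using (case_of_)
open import Relation.Binary.PropositionalEquality
  using (refl; sym; trans; cong; cong₂; subst; module ≡-Reasoning)

isP : Outcome → Bool
isP 𝓟 = true
isP _ = false

parityOutcome : Bool → Outcome
parityOutcome false = 𝓝
parityOutcome true  = 𝓟

isP-parityOutcome : ∀ c → isP (parityOutcome c) ≡ c
isP-parityOutcome false = refl
isP-parityOutcome true  = refl

parityOf : Game → Bool
parityOf g = isP (o⁻ g)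

𝓟⇒leftLoses : ∀ g → parityOf g ≡ true → leftFirst g ≡ false
𝓟⇒leftLoses g g𝓟 with leftFirst g | rightFirst g
𝓟⇒leftLoses g () | true  | true
𝓟⇒leftLoses g () | true  | false
𝓟⇒leftLoses g () | false | true
𝓟⇒leftLoses g _  | false | false = refl

𝓟⇒rightLoses : ∀ g → parityOf g ≡ true → rightFirst g ≡ false
𝓟⇒rightLoses g g𝓟 with leftFirst g | rightFirst g
𝓟⇒rightLoses g () | true  | true
𝓟⇒rightLoses g () | true  | false
𝓟⇒rightLoses g () | false | true
𝓟⇒rightLoses g _  | false | false = refl

leftWins⇒¬𝓟 : ∀ g → leftFirst g ≡ true → parityOf g ≡ false
leftWins⇒¬𝓟 g wins with leftFirst g | rightFirst g
leftWins⇒¬𝓟 g _  | true  | true  = refl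
leftWins⇒¬𝓟 g _  | true  | false = refl
leftWins⇒¬𝓟 g () | false | _

rightWins⇒¬𝓟 : ∀ g → rightFirst g ≡ true → parityOf g ≡ false
rightWins⇒¬𝓟 g wins with leftFirst g | rightFirst g
rightWins⇒¬𝓟 g _  | true  | true  = refl
rightWins⇒¬𝓟 g _  | false | true  = refl
rightWins⇒¬𝓟 g () | _     | false

noneRightLoses : ∀ {x xs} → someRightLoses xs ≡ false → x ∈ xs → rightFirst x ≡ true
noneRightLoses {xs = y ∷ ys} none (here refl) = not-injective (∨-conicalˡ _ _ none)
noneRightLoses {xs = y ∷ ys} none (there m)   = noneRightLoses (∨-conicalʳ _ _ none) m

noneLeftLoses : ∀ {x xs} → someLeftLoses xs ≡ false → x ∈ xs → leftFirst x ≡ true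
noneLeftLoses {xs = y ∷ ys} none (here refl) = not-injective (∨-conicalˡ _ _ none)
noneLeftLoses {xs = y ∷ ys} none (there m)   = noneLeftLoses (∨-conicalʳ _ _ none) m

leftLoses-leftOption : ∀ {g x} → leftFirst g ≡ false → x ∈ leftOpts g → rightFirst x ≡ true
leftLoses-leftOption {⟨ [] ∣ _ ⟩}    ()    _
leftLoses-leftOption {⟨ _ ∷ _ ∣ _ ⟩} loses m = noneRightLoses loses m

rightLoses-rightOption : ∀ {g x} → rightFirst g ≡ false → x ∈ rightOpts g → leftFirst x ≡ true
rightLoses-rightOption {⟨ _ ∣ [] ⟩}    ()    _
rightLoses-rightOption {⟨ _ ∣ _ ∷ _ ⟩} loses m = noneLeftLoses loses m

𝓟-leftOption : ∀ {g x} → parityOf g ≡ true → x ∈ leftOpts g → parityOf x ≡ false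
𝓟-leftOption {g} {x} g𝓟 m = rightWins⇒¬𝓟 x (leftLoses-leftOption {g} (𝓟⇒leftLoses g g𝓟) m)

𝓟-rightOption : ∀ {g x} → parityOf g ≡ true → x ∈ rightOpts g → parityOf x ≡ false
𝓟-rightOption {g} {x} g𝓟 m = leftWins⇒¬𝓟 x (rightLoses-rightOption {g} (𝓟⇒rightLoses g g𝓟) m)

𝓟-hasLeftOption : ∀ {l r} → parityOf ⟨ l ∣ r ⟩ ≡ true → l ≢ []
𝓟-hasLeftOption {l} {r} g𝓟 refl = case 𝓟⇒leftLoses ⟨ l ∣ r ⟩ g𝓟 of λ ()

𝓟-hasRightOption : ∀ {l r} → parityOf ⟨ l ∣ r ⟩ ≡ true → r ≢ []
𝓟-hasRightOption {l} {r} g𝓟 refl = case 𝓟⇒rightLoses ⟨ l ∣ r ⟩ g𝓟 of λ ()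

-- *-like positions of a given parity (false = even, like 0; true = odd, like *).
data Parity : Bool → Game → Set where
  even : ∀ {l r} → All (Parity true) l → All (Parity true) r → Parity false ⟨ l ∣ r ⟩
  odd  : ∀ {x xs y ys} → All (Parity false) (x ∷ xs) → All (Parity false) (y ∷ ys) →
         Parity true ⟨ x ∷ xs ∣ y ∷ ys ⟩

odd′ : ∀ {l r} → All (Parity false) l → All (Parity false) r → l ≢ [] → r ≢ [] →
       Parity true ⟨ l ∣ r ⟩
odd′ {[]}              _  _  l≢[] _    = ⊥-elim (l≢[] refl)
odd′ {_ ∷ _} {[]}      _  _  _    r≢[] = ⊥-elim (r≢[] refl)
odd′ {_ ∷ _} {_ ∷ _} pl pr _    _    = odd pl pr

zero-even : Parity false zeroG
zero-even = even [] []

star-odd : Parity true star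
star-odd = odd (zero-even ∷ []) (zero-even ∷ [])

mutual
  parity-leftFirst : ∀ {c g} → Parity c g → leftFirst g ≡ not c
  parity-leftFirst (even []         _) = refl
  parity-leftFirst (even (px ∷ pxs) _) = someRightLoses-odd (px ∷ pxs)
  parity-leftFirst (odd pl _)          = someRightLoses-even pl

  parity-rightFirst : ∀ {c g} → Parity c g → rightFirst g ≡ not c
  parity-rightFirst (even _ [])         = refl
  parity-rightFirst (even _ (py ∷ pys)) = someLeftLoses-odd (py ∷ pys)
  parity-rightFirst (odd _ pr)          = someLeftLoses-even pr

  someRightLoses-odd : ∀ {x xs} → All (Parity true) (x ∷ xs) → someRightLoses (x ∷ xs) ≡ true
  someRightLoses-odd (px ∷ _) rewrite parity-rightFirst px = refl

  someRightLoses-even : ∀ {xs} → All (Parity false) xs → someRightLoses xs ≡ false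
  someRightLoses-even []         = refl
  someRightLoses-even (px ∷ pxs) rewrite parity-rightFirst px = someRightLoses-even pxs

  someLeftLoses-odd : ∀ {x xs} → All (Parity true) (x ∷ xs) → someLeftLoses (x ∷ xs) ≡ true
  someLeftLoses-odd (px ∷ _) rewrite parity-leftFirst px = refl

  someLeftLoses-even : ∀ {xs} → All (Parity false) xs → someLeftLoses xs ≡ false
  someLeftLoses-even []         = refl
  someLeftLoses-even (px ∷ pxs) rewrite parity-leftFirst px = someLeftLoses-even pxs

parity-outcome : ∀ {c g} → Parity c g → o⁻ g ≡ parityOutcome c
parity-outcome {false} p rewrite parity-leftFirst p | parity-rightFirst p = refl
parity-outcome {true}  p rewrite parity-leftFirst p | parity-rightFirst p = refl

parityOf-parity : ∀ {c g} → Parity c g → parityOf g ≡ c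
parityOf-parity {c} p = trans (cong isP (parity-outcome p)) (isP-parityOutcome c)

parity-unique : ∀ {a b g} → Parity a g → Parity b g → a ≡ b
parity-unique p q = trans (sym (parityOf-parity p)) (parityOf-parity q)

++∷≢[] : ∀ (xs : List Game) {z zs} → xs ++ z ∷ zs ≢ []
++∷≢[] xs e = case ++-conicalʳ xs _ e of λ ()

mutual
  parity-⊕ : ∀ {a b g h} → Parity a g → Parity b h → Parity (a xor b) (g ⊕ h)
  parity-⊕ p@(even pl pr) q@(even ql qr) =
    even (++⁺ (addL-parity pl q) (addR-parity p ql)) (++⁺ (addL-parity pr q) (addR-parity p qr))
  parity-⊕ {g = ⟨ l ∣ r ⟩} {h = h} p@(even pl pr) q@(odd ql qr) =
    odd′ (++⁺ (addL-parity pl q) (addR-parity p ql)) (++⁺ (addL-parity pr q) (addR-parity p qr))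
         (++∷≢[] (addL l h)) (++∷≢[] (addL r h))
  parity-⊕ p@(odd pl pr) q@(even ql qr) =
    odd (++⁺ (addL-parity pl q) (addR-parity p ql)) (++⁺ (addL-parity pr q) (addR-parity p qr))
  parity-⊕ p@(odd pl pr) q@(odd ql qr) =
    even (++⁺ (addL-parity pl q) (addR-parity p ql)) (++⁺ (addL-parity pr q) (addR-parity p qr))

  addL-parity : ∀ {a b xs h} → All (Parity a) xs → Parity b h → All (Parity (a xor b)) (addL xs h)
  addL-parity []         q = []
  addL-parity (px ∷ pxs) q = parity-⊕ px q ∷ addL-parity pxs q

  addR-parity : ∀ {a b g ys} → Parity a g → All (Parity b) ys → All (Parity (a xor b)) (addR g ys)
  addR-parity p []         = []
  addR-parity p (qy ∷ qys) = parity-⊕ p qy ∷ addR-parity p qys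

parity-leftOption : ∀ {c g x} → Parity c g → x ∈ leftOpts g → Parity (not c) x
parity-leftOption (even pl _) m = lookup pl m
parity-leftOption (odd pl _)  m = lookup pl m

parity-rightOption : ∀ {c g x} → Parity c g → x ∈ rightOpts g → Parity (not c) x
parity-rightOption (even _ pr) m = lookup pr m
parity-rightOption (odd _ pr)  m = lookup pr m

mutual
  parity-conj : ∀ {c g} → Parity c g → Parity c (conj g)
  parity-conj (even pl pr)               = even (parity-conjList pr) (parity-conjList pl)
  parity-conj (odd (px ∷ pl) (py ∷ pr)) = odd (parity-conj py ∷ parity-conjList pr)
                                              (parity-conj px ∷ parity-conjList pl)

  parity-conjList : ∀ {b l} → All (Parity b) l → All (Parity b) (conjList l)
  parity-conjList []       = []
  parity-conjList (p ∷ ps) = parity-conj p ∷ parity-conjList ps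

conj-nonzero : ∀ {g} → g ≢ zeroG → conj g ≢ zeroG
conj-nonzero {⟨ [] ∣ [] ⟩}    g≢0 _ = g≢0 refl
conj-nonzero {⟨ _ ∷ _ ∣ _ ⟩}  g≢0 ()
conj-nonzero {⟨ [] ∣ _ ∷ _ ⟩} g≢0 ()

ParityClosed : (Game → Set) → Set
ParityClosed Γ = ∀ {g} → Γ g → Σ Bool (λ c → Parity c g)

same-parity⇒≡ : ∀ {Γ a b g h} → ParityClosed Γ → Parity a g → Parity b h → a ≡ b → g ≡[ Γ ] h
same-parity⇒≡ classify p q refl γ γ∈Γ =
  trans (parity-outcome (parity-⊕ p r)) (sym (parity-outcome (parity-⊕ q r)))
  where r = proj₂ (classify γ∈Γ)

≡⇒same-parity : ∀ {Γ a b g h} → Γ zeroG → Parity a g → Parity b h → g ≡[ Γ ] h → a ≡ b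
≡⇒same-parity {a = a} {b} {g} {h} zero∈Γ p q g≡h = begin
  a                        ≡⟨ sym (xor-identityʳ a) ⟩
  a xor false              ≡⟨ sym (parityOf-parity (parity-⊕ p zero-even)) ⟩
  parityOf (g ⊕ zeroG)     ≡⟨ cong isP (g≡h zeroG zero∈Γ) ⟩
  parityOf (h ⊕ zeroG)     ≡⟨ parityOf-parity (parity-⊕ q zero-even) ⟩
  b xor false              ≡⟨ xor-identityʳ b ⟩
  b                        ∎
  where open ≡-Reasoning

-- A set of *-like positions containing 0 and an odd position; its misère
-- monoid is ℤ/2 = {even, odd}, with the class of each parity represented by `rep`.
record ParityClosure (Γ : Game → Set) : Set where
  field
    classify : ParityClosed Γ
    zero∈    : Γ zeroG
    oddElt   : Σ Game (λ y → Γ y × Parity true y)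

  parity : Elt Γ → Bool
  parity (_ , g∈Γ) = proj₁ (classify g∈Γ)

  parity-of : ∀ x → Parity (parity x) (proj₁ x)
  parity-of (_ , g∈Γ) = proj₂ (classify g∈Γ)

  rep : Bool → Elt Γ
  rep false = zeroG , zero∈
  rep true  = proj₁ oddElt , proj₁ (proj₂ oddElt)

  rep-parity : ∀ c → Parity c (proj₁ (rep c))
  rep-parity false = zero-even
  rep-parity true  = proj₂ (proj₂ oddElt)

  parity-rep : ∀ c → parity (rep c) ≡ c
  parity-rep c = parity-unique (parity-of (rep c)) (rep-parity c)

module Transfer {Γ Δ : Game → Set} (A : ParityClosure Γ) (B : ParityClosure Δ) where
  private
    module A = ParityClosure A
    module B = ParityClosure B

  transfer : Elt Γ → Elt Δ
  transfer x = B.rep (A.parity x)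

  transfer-parity : ∀ x → Parity (A.parity x) (proj₁ (transfer x))
  transfer-parity x = B.rep-parity (A.parity x)

  transfer-cong : ∀ x y → proj₁ x ≡[ Γ ] proj₁ y → proj₁ (transfer x) ≡[ Δ ] proj₁ (transfer y)
  transfer-cong x y x≡y = same-parity⇒≡ B.classify (transfer-parity x) (transfer-parity y)
    (≡⇒same-parity A.zero∈ (A.parity-of x) (A.parity-of y) x≡y)

  round-trip : ∀ x → proj₁ (A.rep (B.parity (transfer x))) ≡[ Γ ] proj₁ x
  round-trip x = same-parity⇒≡ A.classify (A.rep-parity _) (A.parity-of x) (B.parity-rep (A.parity x))

  transfer-hom : ∀ x y (p : Γ (proj₁ x ⊕ proj₁ y)) →
    proj₁ (transfer (proj₁ x ⊕ proj₁ y , p)) ≡[ Δ ] (proj₁ (transfer x) ⊕ proj₁ (transfer y))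
  transfer-hom x y p = same-parity⇒≡ B.classify (transfer-parity _)
    (parity-⊕ (transfer-parity x) (transfer-parity y))
    (parity-unique (A.parity-of (_ , p)) (parity-⊕ (A.parity-of x) (A.parity-of y)))

  transfer-unit : (p : Γ zeroG) → proj₁ (transfer (zeroG , p)) ≡[ Δ ] zeroG
  transfer-unit p = same-parity⇒≡ B.classify (transfer-parity _) zero-even
    (parity-unique (A.parity-of (zeroG , p)) zero-even)

  transfer-outcome : ∀ x → o⁻ (proj₁ (transfer x)) ≡ o⁻ (proj₁ x)
  transfer-outcome x = trans (parity-outcome (transfer-parity x)) (sym (parity-outcome (A.parity-of x)))

parityClosure-iso : ∀ {Γ Δ} → ParityClosure Γ → ParityClosure Δ → MisereIso Γ Δ
parityClosure-iso A B = record
  { to        = AB.transfer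
  ; from      = BA.transfer
  ; to-cong   = AB.transfer-cong
  ; from-cong = BA.transfer-cong
  ; from-to   = AB.round-trip
  ; to-from   = BA.round-trip
  ; to-hom    = AB.transfer-hom
  ; to-unit   = AB.transfer-unit
  ; to-out    = AB.transfer-outcome
  ; from-out  = BA.transfer-outcome
  }
  where
  module AB = Transfer A B
  module BA = Transfer B A

Cl-parity : ∀ {Υ g} → ParityClosed Υ → Cl Υ g → Σ Bool (λ c → Parity c g)
Cl-parity classify (base g∈Υ) = classify g∈Υ
Cl-parity classify (sum m n)  = _ , parity-⊕ (proj₂ (Cl-parity classify m)) (proj₂ (Cl-parity classify n))
Cl-parity classify (optL m k) = _ , parity-leftOption (proj₂ (Cl-parity classify m)) k
Cl-parity classify (optR m k) = _ , parity-rightOption (proj₂ (Cl-parity classify m)) k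

-- Every nonempty closure contains 0 (follow options down to an empty position).
Cl-zero : ∀ {Υ} g → Cl Υ g → Cl Υ zeroG
Cl-zero ⟨ [] ∣ [] ⟩    m = m
Cl-zero ⟨ x ∷ _ ∣ _ ⟩  m = Cl-zero x (optL m (here refl))
Cl-zero ⟨ [] ∣ y ∷ _ ⟩ m = Cl-zero y (optR m (here refl))

cl-zeroG : ∀ {g} → cl zeroG g → g ≡ zeroG
cl-zeroG (base g≡0) = g≡0
cl-zeroG (sum m n) with cl-zeroG m | cl-zeroG n
... | refl | refl = refl
cl-zeroG (optL m k) with cl-zeroG m
cl-zeroG (optL m ()) | refl
cl-zeroG (optR m k) with cl-zeroG m
cl-zeroG (optR m ()) | refl

odd-in-cl : ∀ {c ξ} → Parity c ξ → ξ ≢ zeroG → Σ Game (λ y → cl ξ y × Parity true y)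
odd-in-cl p@(odd _ _)        _   = _ , base refl , p
odd-in-cl (even (px ∷ _) _)  _   = _ , optL (base refl) (here refl) , px
odd-in-cl (even [] (py ∷ _)) _   = _ , optR (base refl) (here refl) , py
odd-in-cl (even [] [])       ξ≢0 = ⊥-elim (ξ≢0 refl)

cl-parityClosure : ∀ {c ξ} → Parity c ξ → ξ ≢ zeroG → ParityClosure (cl ξ)
cl-parityClosure {ξ = ξ} p ξ≢0 = record
  { classify = Cl-parity (λ { refl → _ , p })
  ; zero∈    = Cl-zero ξ (base refl)
  ; oddElt   = odd-in-cl p ξ≢0
  }

starLike⇒≅star : ∀ {c ξ} → Parity c ξ → ξ ≢ zeroG → ξ ≅ₘ star
starLike⇒≅star p ξ≢0 = parityClosure-iso (cl-parityClosure p ξ≢0) (cl-parityClosure star-odd (λ ()))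

addL-∈ : ∀ {x xs} h → x ∈ xs → (x ⊕ h) ∈ addL xs h
addL-∈ h (here refl) = here refl
addL-∈ h (there m)   = there (addL-∈ h m)

⊕-leftOption : ∀ {g x} h → x ∈ leftOpts g → (x ⊕ h) ∈ leftOpts (g ⊕ h)
⊕-leftOption {⟨ _ ∣ _ ⟩} ⟨ _ ∣ _ ⟩ m = ∈-++⁺ˡ (addL-∈ _ m)

⊕-rightOption : ∀ {g x} h → x ∈ rightOpts g → (x ⊕ h) ∈ rightOpts (g ⊕ h)
⊕-rightOption {⟨ _ ∣ _ ⟩} ⟨ _ ∣ _ ⟩ m = ∈-++⁺ˡ (addL-∈ _ m)

xor-true≡false : ∀ b → b xor true ≡ false → b ≡ true
xor-true≡false b e = not-injective (trans (sym (trans (xor-comm b true) (true-xor b))) e)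

module FromStarIso {ξ : Game} (I : ξ ≅ₘ star) where
  open MisereIso I
  private
    module S = ParityClosure (cl-parityClosure star-odd (λ ()))

  -- Parity of outcome is preserved by the isomorphism, hence additive on cl(ξ).
  parityOf-to : ∀ x → parityOf (proj₁ x) ≡ S.parity (to x)
  parityOf-to x = trans (cong isP (sym (to-out x))) (parityOf-parity (S.parity-of (to x)))

  parityOf-⊕ : ∀ {g h} → cl ξ g → cl ξ h → parityOf (g ⊕ h) ≡ parityOf g xor parityOf h
  parityOf-⊕ {g} {h} m n = begin
    parityOf (g ⊕ h)                    ≡⟨ parityOf-to (g ⊕ h , sum m n) ⟩
    S.parity (to (g ⊕ h , sum m n))     ≡⟨ ≡⇒same-parity S.zero∈ (S.parity-of (to (g ⊕ h , sum m n)))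
                                            (parity-⊕ (S.parity-of (to (g , m))) (S.parity-of (to (h , n))))
                                            (to-hom (g , m) (h , n) (sum m n)) ⟩
    S.parity (to (g , m)) xor S.parity (to (h , n))
                                        ≡⟨ sym (cong₂ _xor_ (parityOf-to (g , m)) (parityOf-to (h , n))) ⟩
    parityOf g xor parityOf h           ∎
    where open ≡-Reasoning

  y : Game
  y = proj₁ (from (star , base refl))

  y∈cl : cl ξ y
  y∈cl = proj₂ (from (star , base refl))

  y-odd : parityOf y ≡ true
  y-odd = cong isP (from-out (star , base refl))

  -- Options of an even g are odd: g + y is 𝓟, so its option x + y is not.
  even-leftOption : ∀ {g x} → cl ξ g → parityOf g ≡ false → x ∈ leftOpts g → parityOf x ≡ true
  even-leftOption {g} {x} m g-even k = xor-true≡false (parityOf x) (begin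
    parityOf x xor true   ≡⟨ sym (trans (parityOf-⊕ (optL m k) y∈cl) (cong (parityOf x xor_) y-odd)) ⟩
    parityOf (x ⊕ y)      ≡⟨ 𝓟-leftOption {g ⊕ y} g⊕y-odd (⊕-leftOption {g} y k) ⟩
    false                 ∎)
    where
    open ≡-Reasoning
    g⊕y-odd : parityOf (g ⊕ y) ≡ true
    g⊕y-odd = trans (parityOf-⊕ m y∈cl) (cong₂ _xor_ g-even y-odd)

  even-rightOption : ∀ {g x} → cl ξ g → parityOf g ≡ false → x ∈ rightOpts g → parityOf x ≡ true
  even-rightOption {g} {x} m g-even k = xor-true≡false (parityOf x) (begin
    parityOf x xor true   ≡⟨ sym (trans (parityOf-⊕ (optR m k) y∈cl) (cong (parityOf x xor_) y-odd)) ⟩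
    parityOf (x ⊕ y)      ≡⟨ 𝓟-rightOption {g ⊕ y} g⊕y-odd (⊕-rightOption {g} y k) ⟩
    false                 ∎)
    where
    open ≡-Reasoning
    g⊕y-odd : parityOf (g ⊕ y) ≡ true
    g⊕y-odd = trans (parityOf-⊕ m y∈cl) (cong₂ _xor_ g-even y-odd)

  mutual
    parity-cl : ∀ g → cl ξ g → Parity (parityOf g) g
    parity-cl ⟨ l ∣ r ⟩ m with parityOf ⟨ l ∣ r ⟩ in e
    ... | false = even (options l (optL m) (even-leftOption m e))
                       (options r (optR m) (even-rightOption m e))
    ... | true  = odd′ (options l (optL m) (𝓟-leftOption {⟨ l ∣ r ⟩} e))
                       (options r (optR m) (𝓟-rightOption {⟨ l ∣ r ⟩} e))
                       (𝓟-hasLeftOption {l} {r} e) (𝓟-hasRightOption {l} {r} e)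

    options : ∀ {b} xs → (∀ {x} → x ∈ xs → cl ξ x) → (∀ {x} → x ∈ xs → parityOf x ≡ b) →
              All (Parity b) xs
    options []       _  _    = []
    options (x ∷ xs) in-cl par =
      subst (λ c → Parity c x) (par (here refl)) (parity-cl x (in-cl (here refl)))
      ∷ options xs (λ k → in-cl (there k)) (λ k → par (there k))

  ≅star⇒parity : Parity (parityOf ξ) ξ
  ≅star⇒parity = parity-cl ξ (base refl)

  -- cl(0) = {0} contains no 𝓟-position.
  ≅star⇒nonzero : ξ ≢ zeroG
  ≅star⇒nonzero refl = case trans (sym (cong parityOf (cl-zeroG y∈cl))) y-odd of λ ()

open FromStarIso using (≅star⇒parity; ≅star⇒nonzero)

allParity : ∀ b xs → (∀ x → x ∈ xs → x ≅ₘ star) → (∀ x → x ∈ xs → parityOf x ≡ b) →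
            All (Parity b) xs
allParity b xs iso par = tabulate λ {x} k → subst (λ c → Parity c x) (par x k) (≅star⇒parity (iso x k))

node : ∀ b {x xs y ys} → All (Parity b) (x ∷ xs) → All (Parity b) (y ∷ ys) →
       Parity (not b) ⟨ x ∷ xs ∣ y ∷ ys ⟩
node false = odd
node true  = even

theorem7p3p9 : (ξs κs : List Game) → ξs ≢ [] → κs ≢ [] →
  (∀ x → x ∈ ξs → x ≅ₘ star) → (∀ y → y ∈ κs → y ≅ₘ star) →
  ((∀ x y → x ∈ ξs → y ∈ κs → o⁻ x ≡ o⁻ y) → ⟨ ξs ∣ κs ⟩ ≅ₘ star)
  × ((∀ x → x ∈ ξs → o⁻ x ≡ 𝓟) → ⟨ ξs ∣ [] ⟩ ≅ₘ star)
  × ((∀ x → x ∈ ξs → o⁻ x ≡ 𝓝) → (∀ y → y ∈ κs → o⁻ y ≡ 𝓝) →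
       (⟨ ξs ∣ zeroG ∷ [] ⟩ ≅ₘ star)
       × (⟨ ξs ∣ κs ++ zeroG ∷ [] ⟩ ≅ₘ star)
       × (⟨ ξs ++ zeroG ∷ [] ∣ κs ++ zeroG ∷ [] ⟩ ≅ₘ star))
  × (∀ x → x ∈ ξs → conj x ≅ₘ star)
  × (∀ y → y ∈ κs → conj y ≅ₘ star)
theorem7p3p9 []      _  ξs≢[] _     _ _ = ⊥-elim (ξs≢[] refl)
theorem7p3p9 (_ ∷ _) [] _     κs≢[] _ _ = ⊥-elim (κs≢[] refl)
theorem7p3p9 ξs@(ξ₀ ∷ _) κs@(κ₀ ∷ _) _ _ ξ≅ κ≅ =
  same-outcomes , all-𝓟 , all-𝓝 , conj≅ ξ≅ , conj≅ κ≅
  where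
  conj≅ : ∀ {xs} → (∀ x → x ∈ xs → x ≅ₘ star) → ∀ x → x ∈ xs → conj x ≅ₘ star
  conj≅ iso x k = starLike⇒≅star (parity-conj (≅star⇒parity (iso x k))) (conj-nonzero (≅star⇒nonzero (iso x k)))

  same-outcomes : (∀ x y → x ∈ ξs → y ∈ κs → o⁻ x ≡ o⁻ y) → ⟨ ξs ∣ κs ⟩ ≅ₘ star
  same-outcomes same = starLike⇒≅star
    (node (parityOf κ₀) (allParity _ ξs ξ≅ λ x k → cong isP (same x κ₀ k (here refl)))
                        (allParity _ κs κ≅ λ y k → cong isP (trans (sym (same ξ₀ y (here refl) k))
                                                                   (same ξ₀ κ₀ (here refl) (here refl)))))
    (λ ())

  all-𝓟 : (∀ x → x ∈ ξs → o⁻ x ≡ 𝓟) → ⟨ ξs ∣ [] ⟩ ≅ₘ star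
  all-𝓟 ξ𝓟 = starLike⇒≅star (even (allParity true ξs ξ≅ λ x k → cong isP (ξ𝓟 x k)) []) (λ ())

  all-𝓝 : (∀ x → x ∈ ξs → o⁻ x ≡ 𝓝) → (∀ y → y ∈ κs → o⁻ y ≡ 𝓝) →
          (⟨ ξs ∣ zeroG ∷ [] ⟩ ≅ₘ star) × (⟨ ξs ∣ κs ++ zeroG ∷ [] ⟩ ≅ₘ star)
          × (⟨ ξs ++ zeroG ∷ [] ∣ κs ++ zeroG ∷ [] ⟩ ≅ₘ star)
  all-𝓝 ξ𝓝 κ𝓝 = starLike⇒≅star (odd ξ-even (zero-even ∷ [])) (λ ())
              , starLike⇒≅star (odd ξ-even (++⁺ κ-even (zero-even ∷ []))) (λ ())
              , starLike⇒≅star (odd (++⁺ ξ-even (zero-even ∷ [])) (++⁺ κ-even (zero-even ∷ []))) (λ ())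
    where
    ξ-even = allParity false ξs ξ≅ λ x k → cong isP (ξ𝓝 x k)
    κ-even = allParity false κs κ≅ λ y k → cong isP (κ𝓝 y k)
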